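{- Let $f_1,f_2\in V$ and $\mathcal{C}=\langle f_1,f_2\rangle_{q^n}$ be such that $L\in\mathcal{L}_\mathcal{C}$ is a proper $\mathbb{F}_q$-linear set of rank $n$ in $\mathrm{PG}(1,q^n)$. Let $A_i$ be the number of elements of rank $i$ in $\mathcal{C}$ and $B_i$ the number of elements of rank $i$ in $\mathcal{C}^\perp$. Then $B_1=0$.
   Context: $V=\mathrm{End}_{\mathbb{F}_q}(\mathbb{F}_{q^n})$, viewed as the $\mathbb{F}_{q^n}$-space of linearised polynomials $f=\sum_{i=0}^{n-1}f_ix^{q^i}$; rank means rank as an $\mathbb{F}_q$-linear map. $\mathcal{C}^\perp=\{g\in V:\sum_i f_ig_i=0\ \forall f\in\mathcal{C}\}$. $\mathcal{L}_\mathcal{C}$ is the set of linear sets $L_{g_1,g_2}=\{(g_1(x),g_2(x))_{q^n}:x\in\mathbb{F}_{q^n}^*\}$ over all $\mathbb{F}_{q^n}$-bases $g_1,g_2$ of $\mathcal{C}$. A linear set is proper if it contains more than one point. -}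

module Defs where

open import Level using (0ℓ)
open import Data.Nat as ℕ using (ℕ; zero; suc; _≤_)
open import Data.Nat.Primality using (Prime)
import Data.Fin
open Data.Fin using (Fin)
open import Data.List using (List; length)
open import Data.List.Membership.Propositional using (_∈_)
open import Data.List.Relation.Unary.Unique.Propositional using (Unique)
open import Data.Product using (Σ; ∃; ∃-syntax; _×_; _,_)
open import Relation.Nullary using (¬_; Dec)
open import Relation.Binary.PropositionalEquality using (_≡_)
open import Algebra.Structures using (IsCommutativeRing)

record FiniteField (q n : ℕ) : Set₁ where
  field
    K    : Set
    _+_  : K → K → K
    _*_  : K → K → K
    -_   : K → K
    0#   : K
    1#   : K
    isCommutativeRing : IsCommutativeRing _≡_ _+_ _*_ -_ 0# 1#
    0≢1  : ¬ (0# ≡ 1#)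
    inverse : ∀ x → ¬ (x ≡ 0#) → ∃[ y ] (x * y ≡ 1#)
    _≟_  : (x y : K) → Dec (x ≡ y)
    elements : List K
    complete : ∀ x → x ∈ elements
    unique   : Unique elements
    card     : length elements ≡ q ℕ.^ n
  infixl 6 _+_
  infixl 7 _*_

module Setup {q n : ℕ} (𝔽 : FiniteField q n) where
  open FiniteField 𝔽 public

  _^_ : K → ℕ → K
  x ^ zero  = 1#
  x ^ suc k = x * (x ^ k)

  -- the subfield F_q of F_{q^n}: the fixed points of x ↦ x^q
  InFq : K → Set
  InFq a = a ^ q ≡ a

  sumFin : ∀ {r} → (Fin r → K) → K
  sumFin {zero}  h = 0#
  sumFin {suc r} h = h Data.Fin.zero + sumFin (λ i → h (Data.Fin.suc i))

  -- V : linearised polynomials f = Σ_{i<n} f_i x^{q^i}, given by coefficients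
  V : Set
  V = Fin n → K

  eval : V → K → K
  eval f x = sumFin (λ i → f i * (x ^ (q ℕ.^ Data.Fin.toℕ i)))

  _≐_ : V → V → Set
  f ≐ g = ∀ i → f i ≡ g i

  lin : K → V → K → V → V
  lin a f b g i = a * f i + b * g i

  0V : V
  0V i = 0#

  -- F_q-dimension of the image of an F_q-linear map φ : F_{q^n} → A,
  -- where A carries addition, zero and scalar multiplication by F_{q^n}
  -- (restricted to F_q-scalars). "HasImageDim φ r" : the image of φ has
  -- an F_q-basis of size r.
  module FqSpace {A : Set} (_⊕_ : A → A → A) (0A : A) (_·_ : K → A → A) where
    comb : ∀ {r} → (Fin r → K) → (Fin r → A) → A
    comb {zero}  c v = 0A
    comb {suc r} c v = (c Data.Fin.zero · v Data.Fin.zero)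
                         ⊕ comb (λ i → c (Data.Fin.suc i)) (λ i → v (Data.Fin.suc i))

    FqCoeffs : ∀ {r} → (Fin r → K) → Set
    FqCoeffs c = ∀ i → InFq (c i)

    FqIndependent : ∀ {r} → (Fin r → A) → Set
    FqIndependent v = ∀ c → FqCoeffs c → comb c v ≡ 0A → ∀ i → c i ≡ 0#

    HasImageDim : (K → A) → ℕ → Set
    HasImageDim φ r =
      Σ (Fin r → A) λ v →
        (∀ i → ∃[ x ] φ x ≡ v i)
      × FqIndependent v
      × (∀ x → Σ (Fin r → K) λ c → FqCoeffs c × φ x ≡ comb c v)

  module OnK = FqSpace _+_ 0# _*_

  HasRank : V → ℕ → Set
  HasRank f r = OnK.HasImageDim (eval f) r

  InSpan : V → V → V → Set
  InSpan f1 f2 g = ∃[ a ] ∃[ b ] (g ≐ lin a f1 b f2)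

  InDual : V → V → V → Set
  InDual f1 f2 g = ∀ f → InSpan f1 f2 f → sumFin (λ i → f i * g i) ≡ 0#

  IsBasisOf : V → V → V → V → Set
  IsBasisOf f1 f2 g1 g2 =
      InSpan f1 f2 g1 × InSpan f1 f2 g2
    × (∀ a b → lin a g1 b g2 ≐ 0V → (a ≡ 0#) × (b ≡ 0#))
    × (∀ f → InSpan f1 f2 f → InSpan g1 g2 f)

  K² : Set
  K² = K × K

  _⊕²_ : K² → K² → K²
  (a , b) ⊕² (c , d) = (a + c , b + d)

  0² : K²
  0² = (0# , 0#)

  _·²_ : K → K² → K²
  λ' ·² (a , b) = (λ' * a , λ' * b)

  module OnK² = FqSpace _⊕²_ 0² _·²_

  SamePoint : K² → K² → Set
  SamePoint u v = ∃[ λ' ] (¬ (λ' ≡ 0#) × v ≡ λ' ·² u)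

  -- the F_q-subspace U_{g1,g2} = {(g1(x), g2(x)) : x ∈ F_{q^n}} defining L_{g1,g2}
  U : V → V → K → K²
  U g1 g2 x = (eval g1 x , eval g2 x)

  LinearSetRank : V → V → ℕ → Set
  LinearSetRank g1 g2 r = OnK².HasImageDim (U g1 g2) r

  Proper : V → V → Set
  Proper g1 g2 =
    ∃[ x ] ∃[ y ] (¬ (x ≡ 0#) × ¬ (y ≡ 0#)
      × ¬ (U g1 g2 x ≡ 0²) × ¬ (U g1 g2 y ≡ 0²)
      × ¬ SamePoint (U g1 g2 x) (U g1 g2 y))

  SomeProperRankN : V → V → Set
  SomeProperRankN f1 f2 =
    ∃[ g1 ] ∃[ g2 ] (IsBasisOf f1 f2 g1 g2 × Proper g1 g2 × LinearSetRank g1 g2 n)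

IsPrimePower : ℕ → Set
IsPrimePower q = ∃[ p ] ∃[ k ] (Prime p × 1 ≤ k × q ≡ p ℕ.^ k)

-- Let g ∈ C^⊥ have rank 1, so g takes its values in c F_q for some c ≠ 0. Then h = c⁻¹ g
-- satisfies h(x)^q = h(x) for all x; as a linearised polynomial of q-degree < n is determined
-- by its values (it has degree < q^n and every x is a root of the difference), comparing
-- coefficients gives g_i = c β^{q^i} with β ≠ 0. Orthogonality then reads c f(β) = 0 for all
-- f ∈ C, so β is a common nonzero root of any basis g₁, g₂ of C, and the F_q-linear map
-- x ↦ (g₁(x), g₂(x)) has a nontrivial kernel: U_{g₁,g₂} cannot have dimension n. The last
-- step compares dimensions by counting, using |F_q| ≥ q.

module Submission where

open import Defs
open import Data.Nat using (ℕ; _≤_)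
open import Data.Product using (∃-syntax; _×_)
open import Relation.Nullary using (¬_)

open import Level using (0ℓ)
open import Data.Nat as ℕ using (zero; suc; _<_; z≤n; s≤s; _∸_; _!)
import Data.Nat.Properties as ℕ
open import Data.Nat.Divisibility using (_∣_; divides; ∣1⇒≡1; ∣⇒≤; m∣m*n)
open import Data.Nat.DivMod using (m/n*n≡m)
open import Data.Nat.Primality using (Prime; euclidsLemma; ¬prime[0]; ¬prime[1]; prime⇒nonTrivial)
open import Data.Nat.Combinatorics using (_C_; k![n∸k]!∣n!; nCn≡1)
import Algebra.Properties.CommutativeSemiring.Binomial as Binomial
open import Data.Nat.Combinatorics.Specification using (nCk≡n!/k![n-k]!)
open import Data.Fin as Fin using (Fin; toℕ; fromℕ; inject₁)
import Data.Fin.Properties as Fin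
open import Data.List using (List; []; _∷_; length; map; filter; foldr; replicate; _++_; lookup; tabulate)
import Data.List.Properties as List
open import Data.List.Membership.Propositional using (_∈_)
open import Data.List.Membership.Propositional.Properties
  using (∈-map⁺; ∈-map⁻; ∈-filter⁺; ∈-filter⁻; ∈-length; ∈-lookup)
open import Data.List.Membership.Propositional.Properties.WithK using (unique∧set⇒bag)
open import Data.List.Relation.Binary.BagAndSetEquality using (∼bag⇒↭)
open import Data.List.Relation.Binary.Permutation.Propositional using (_↭_; ↭⇒↭ₛ)
import Data.List.Relation.Binary.Permutation.Setoid.Properties as PermProperties
open import Data.List.Relation.Unary.All as All using (All; []; _∷_)
open import Data.List.Relation.Unary.All.Properties using () renaming (tabulate⁻ to All-tabulate⁻)
open import Data.List.Relation.Unary.AllPairs using ([]; _∷_)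
open import Data.List.Relation.Unary.Any using (index)
open import Data.List.Relation.Unary.Any.Properties using (lookup-index)
open import Data.List.Relation.Unary.Unique.Propositional using (Unique)
import Data.List.Relation.Unary.Unique.Propositional.Properties as Unique
open import Data.Product using (_,_; proj₁; proj₂)
open import Data.Sum using (_⊎_; inj₁; inj₂)
open import Data.Empty using (⊥-elim)
open import Function.Bundles using (mk⇔)
open import Relation.Nullary using (Dec; yes; no)
open import Relation.Unary using (Pred; Decidable)
open import Relation.Unary.Properties using (∁?)
open import Relation.Binary.PropositionalEquality
open import Function.Base using (_∘_)
open import Algebra.Bundles using (CommutativeRing)
open import Data.Maybe using (nothing)
import Tactic.RingSolver.Core.AlmostCommutativeRing as AlmostCommutativeRing
import Tactic.RingSolver.NonReflective as RingSolver

prime∤! : ∀ {p} → Prime p → ∀ {m} → m < p → ¬ p ∣ m !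
prime∤! pp {zero} _ p∣1 with ∣1⇒≡1 p∣1
... | refl = ¬prime[1] pp
prime∤! pp {suc m} m<p p∣m! with euclidsLemma (suc m) (m !) pp p∣m!
... | inj₁ p∣1+m = ℕ.<⇒≱ m<p (∣⇒≤ p∣1+m)
... | inj₂ p∣m!  = prime∤! pp (ℕ.<-trans (ℕ.n<1+n m) m<p) p∣m!

prime∣C : ∀ {p k} → Prime p → 0 < k → k < p → p ∣ p C k
prime∣C {p@(suc p′)} {k} pp 0<k k<p
  with euclidsLemma (p C k) (k ! ℕ.* (p ∸ k) !) pp (subst (p ∣_) (sym p!≡) (m∣m*n (p′ !)))
  where
  instance _ = k ℕ.!* (p ∸ k) !≢0
  p!≡ : (p C k) ℕ.* (k ! ℕ.* (p ∸ k) !) ≡ p !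
  p!≡ = trans (cong (ℕ._* (k ! ℕ.* (p ∸ k) !)) (nCk≡n!/k![n-k]! (ℕ.<⇒≤ k<p)))
              (m/n*n≡m (k![n∸k]!∣n! (ℕ.<⇒≤ k<p)))
... | inj₁ p∣C = p∣C
... | inj₂ p∣k![p-k]! with euclidsLemma (k !) ((p ∸ k) !) pp p∣k![p-k]!
...   | inj₁ p∣k! = ⊥-elim (prime∤! pp k<p p∣k!)
...   | inj₂ p∣[p-k]! = ⊥-elim (prime∤! pp (ℕ.∸-monoʳ-< 0<k (ℕ.<⇒≤ k<p)) p∣[p-k]!)

primePower⇒>1 : ∀ {q} → IsPrimePower q → 1 < q
primePower⇒>1 (p , k , p-prime , 1≤k , refl) =
  ℕ.<-≤-trans (ℕ.nonTrivial⇒n>1 p) (subst (ℕ._≤ p ℕ.^ k) (ℕ.*-identityʳ p) (ℕ.^-monoʳ-≤ p 1≤k))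
  where
  instance
    _ = prime⇒nonTrivial p-prime
    _ = ℕ.nonTrivial⇒nonZero p

^-injectiveʳ : ∀ {b k l} → 1 < b → b ℕ.^ k ≡ b ℕ.^ l → k ≡ l
^-injectiveʳ {b} 1<b b^k≡b^l = ℕ.≤-antisym
  (ℕ.≮⇒≥ λ l<k → ℕ.<-irrefl (sym b^k≡b^l) (ℕ.^-monoʳ-< b 1<b l<k))
  (ℕ.≮⇒≥ λ k<l → ℕ.<-irrefl b^k≡b^l (ℕ.^-monoʳ-< b 1<b k<l))

pow-form : ∀ d j → ∃[ l ] suc d ℕ.^ suc j ≡ suc (d ℕ.* suc l)
pow-form d zero    = zero , cong suc (trans (ℕ.*-identityʳ d) (sym (ℕ.*-identityʳ d)))
pow-form d (suc j) with pow-form d j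
... | l , eq = l ℕ.+ suc (d ℕ.* suc l) , trans (cong (suc d ℕ.*_) eq)
                 (cong suc (sym (ℕ.*-distribˡ-+ d (suc l) (suc (d ℕ.* suc l)))))

finToFun-injective : ∀ {k l} {s t : Fin (l ℕ.^ k)} →
                     (∀ i → Fin.finToFun {l} {k} s i ≡ Fin.finToFun t i) → s ≡ t
finToFun-injective {k} {l} {s} {t} s≗t = begin
  s                                     ≡⟨ sym (Fin.funToFin-finToFin {k} {l} s) ⟩
  Fin.funToFin (Fin.finToFun {l} {k} s) ≡⟨ funToFin-cong s≗t ⟩
  Fin.funToFin (Fin.finToFun {l} {k} t) ≡⟨ Fin.funToFin-finToFin {k} {l} t ⟩
  t                                     ∎
  where
  open ≡-Reasoning
  funToFin-cong : ∀ {k} {f g : Fin k → Fin l} → (∀ i → f i ≡ g i) → Fin.funToFin f ≡ Fin.funToFin g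
  funToFin-cong {zero}  f≗g = refl
  funToFin-cong {suc k} f≗g = cong₂ Fin.combine (f≗g Fin.zero) (funToFin-cong (f≗g ∘ Fin.suc))

module _ {A : Set} where

  length-filter+length-filter-∁ : ∀ {P : Pred A 0ℓ} (P? : Decidable P) xs →
    length (filter P? xs) ℕ.+ length (filter (∁? P?) xs) ≡ length xs
  length-filter+length-filter-∁ P? [] = refl
  length-filter+length-filter-∁ P? (x ∷ xs) with P? x
  ... | yes _ = cong suc (length-filter+length-filter-∁ P? xs)
  ... | no _  = trans (ℕ.+-suc _ _) (cong suc (length-filter+length-filter-∁ P? xs))

  Unique-All≡⇒length≤1 : ∀ {a : A} {xs} → Unique xs → All (_≡ a) xs → length xs ≤ 1
  Unique-All≡⇒length≤1 [] [] = z≤n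
  Unique-All≡⇒length≤1 (_ ∷ []) (_ ∷ []) = s≤s z≤n
  Unique-All≡⇒length≤1 ((x≢y ∷ _) ∷ _) (refl ∷ refl ∷ _) = ⊥-elim (x≢y refl)

  lookup-injective : ∀ {xs : List A} → Unique xs → ∀ i j → lookup xs i ≡ lookup xs j → i ≡ j
  lookup-injective (_ ∷ _)         Fin.zero    Fin.zero    _  = refl
  lookup-injective (x∉xs ∷ _)      Fin.zero    (Fin.suc j) eq = ⊥-elim (All.lookup x∉xs (∈-lookup j) eq)
  lookup-injective (x∉xs ∷ _)      (Fin.suc i) Fin.zero    eq = ⊥-elim (All.lookup x∉xs (∈-lookup i) (sym eq))
  lookup-injective (_ ∷ xs!)       (Fin.suc i) (Fin.suc j) eq = cong Fin.suc (lookup-injective xs! i j eq)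

  map-↭ : ∀ (f : A → A) {xs} → (∀ {x y} → f x ≡ f y → x ≡ y) → Unique xs →
          (∀ {x} → x ∈ xs → f x ∈ xs) → (∀ {y} → y ∈ xs → ∃[ x ] (x ∈ xs × f x ≡ y)) →
          map f xs ↭ xs
  map-↭ f {xs} f-inj xs! into onto =
    ∼bag⇒↭ (unique∧set⇒bag (Unique.map⁺ f-inj xs!) xs! (mk⇔ from-map to-map))
    where
    from-map : ∀ {y} → y ∈ map f xs → y ∈ xs
    from-map y∈ with ∈-map⁻ f y∈
    ... | x , x∈ , refl = into x∈
    to-map : ∀ {y} → y ∈ xs → y ∈ map f xs
    to-map y∈ with onto y∈
    ... | x , x∈ , refl = ∈-map⁺ f x∈

module Field {q n : ℕ} (𝔽 : FiniteField q n) where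

  open Setup 𝔽

  commutativeRing : CommutativeRing 0ℓ 0ℓ
  commutativeRing = record { isCommutativeRing = isCommutativeRing }

  open CommutativeRing commutativeRing public
    using ( _-_; +-assoc; +-comm; +-identityˡ; +-identityʳ; -‿inverseˡ; -‿inverseʳ
          ; *-assoc; *-comm; *-identityˡ; *-identityʳ; zeroˡ; zeroʳ
          ; ring; semiring; commutativeSemiring; +-commutativeMonoid; +-isCommutativeMonoid
          ; *-isCommutativeMonoid; *-commutativeSemigroup)
  open import Algebra.Properties.Ring ring public
    using ( +-cancelˡ; +-cancelʳ; x∙y⁻¹≈ε⇒x≈y; x≈y⇒x∙y⁻¹≈ε; -0#≈0#; +-inverseʳ-unique
          ; [y-z]x≈yx-zx)
  open import Algebra.Properties.Semiring.Mult semiring public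
    using (×-assocˡ; ×-assoc-*; ×1-homo-*) renaming (_×_ to _⨯_)
  open import Algebra.Properties.CommutativeMonoid.Sum +-commutativeMonoid public
    using (sum; sum-cong-≗; sum-replicate-zero; ∑-distrib-+; ∑-comm; sum-init-last; sum-remove)
  open import Algebra.Properties.Semiring.Sum semiring public using (*-distribˡ-sum; *-distribʳ-sum)
  open import Algebra.Properties.CommutativeSemigroup *-commutativeSemigroup public
    using () renaming (x∙yz≈y∙xz to x*yz≡y*xz)
  import Algebra.Properties.Semiring.Exp semiring as Exp
  import Algebra.Properties.CommutativeSemiring.Exp commutativeSemiring as CExp
  module Solver = RingSolver (AlmostCommutativeRing.fromCommutativeRing commutativeRing (λ _ → nothing))
  open Solver using (solve; _⊕_; _⊗_; ⊝_; _⊜_; Κ)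
  open ≡-Reasoning

  x*y≡0⇒x≡0⊎y≡0 : ∀ {x y} → x * y ≡ 0# → x ≡ 0# ⊎ y ≡ 0#
  x*y≡0⇒x≡0⊎y≡0 {x} {y} xy≡0 with x ≟ 0#
  ... | yes x≡0 = inj₁ x≡0
  ... | no x≢0 with inverse x x≢0
  ...   | x⁻¹ , xx⁻¹≡1 = inj₂ (begin
    y               ≡⟨ sym (*-identityˡ y) ⟩
    1# * y          ≡⟨ cong (_* y) (trans (sym xx⁻¹≡1) (*-comm x x⁻¹)) ⟩
    (x⁻¹ * x) * y   ≡⟨ *-assoc x⁻¹ x y ⟩
    x⁻¹ * (x * y)   ≡⟨ cong (x⁻¹ *_) xy≡0 ⟩
    x⁻¹ * 0#        ≡⟨ zeroʳ x⁻¹ ⟩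
    0#              ∎)

  *-≢0 : ∀ {x y} → ¬ x ≡ 0# → ¬ y ≡ 0# → ¬ x * y ≡ 0#
  *-≢0 x≢0 y≢0 xy≡0 with x*y≡0⇒x≡0⊎y≡0 xy≡0
  ... | inj₁ x≡0 = x≢0 x≡0
  ... | inj₂ y≡0 = y≢0 y≡0

  *-cancelʳ-≢0 : ∀ {x y} c → ¬ c ≡ 0# → x * c ≡ y * c → x ≡ y
  *-cancelʳ-≢0 {x} {y} c c≢0 xc≡yc
    with x*y≡0⇒x≡0⊎y≡0 (trans ([y-z]x≈yx-zx c x y) (x≈y⇒x∙y⁻¹≈ε xc≡yc))
  ... | inj₁ x-y≡0 = x∙y⁻¹≈ε⇒x≈y x y x-y≡0
  ... | inj₂ c≡0   = ⊥-elim (c≢0 c≡0)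

  *-cancelˡ-≢0 : ∀ {x y} c → ¬ c ≡ 0# → c * x ≡ c * y → x ≡ y
  *-cancelˡ-≢0 {x} {y} c c≢0 cx≡cy = *-cancelʳ-≢0 c c≢0 (trans (*-comm x c) (trans cx≡cy (*-comm c y)))

  ^≡Exp^ : ∀ x k → x ^ k ≡ x Exp.^ k
  ^≡Exp^ x zero    = refl
  ^≡Exp^ x (suc k) = cong (x *_) (^≡Exp^ x k)

  ^-assocʳ : ∀ x k l → (x ^ k) ^ l ≡ x ^ (k ℕ.* l)
  ^-assocʳ x k l rewrite ^≡Exp^ (x ^ k) l | ^≡Exp^ x k | ^≡Exp^ x (k ℕ.* l) = Exp.^-assocʳ x k l

  ^-distrib-* : ∀ x y k → (x * y) ^ k ≡ x ^ k * y ^ k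
  ^-distrib-* x y k rewrite ^≡Exp^ (x * y) k | ^≡Exp^ x k | ^≡Exp^ y k = CExp.^-distrib-* x y k

  ^-≢0 : ∀ {x} k → ¬ x ≡ 0# → ¬ x ^ k ≡ 0#
  ^-≢0 zero    x≢0 1≡0 = 0≢1 (sym 1≡0)
  ^-≢0 (suc k) x≢0     = *-≢0 x≢0 (^-≢0 k x≢0)

  1^ : ∀ k → 1# ^ k ≡ 1#
  1^ zero    = refl
  1^ (suc k) = trans (*-identityˡ _) (1^ k)

  0^ : ∀ {k} → 1 ≤ k → 0# ^ k ≡ 0#
  0^ {suc k} _ = zeroˡ _

  sumFin≡sum : ∀ {r} (t : Fin r → K) → sumFin t ≡ sum t
  sumFin≡sum {zero}  t = refl
  sumFin≡sum {suc r} t = cong (t Fin.zero +_) (sumFin≡sum (λ i → t (Fin.suc i)))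

  monomials : V → K → Fin n → K
  monomials f x i = f i * x ^ (q ℕ.^ toℕ i)

  eval≡sum : ∀ f x → eval f x ≡ sum (monomials f x)
  eval≡sum f x = sumFin≡sum (monomials f x)

  sum-zero : ∀ {r} (t : Fin r → K) → (∀ i → t i ≡ 0#) → sum t ≡ 0#
  sum-zero {r} t t≗0 = trans (sum-cong-≗ t≗0) (sum-replicate-zero r)

  eval-≐0 : ∀ f → f ≐ 0V → ∀ x → eval f x ≡ 0#
  eval-≐0 f f≐0 x = trans (eval≡sum f x) (sum-zero _ λ i → trans (cong (_* _) (f≐0 i)) (zeroˡ _))

  sum-spike : ∀ {r} (t : Fin r → K) i → (∀ j → ¬ j ≡ i → t j ≡ 0#) → sum t ≡ t i
  sum-spike {suc r} t i t≡0 = begin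
    sum t                          ≡⟨ sum-remove t ⟩
    t i + sum (t ∘ Fin.punchIn i)  ≡⟨ cong (t i +_) (sum-zero _ (λ j → t≡0 _ (Fin.punchInᵢ≢i i j))) ⟩
    t i + 0#                       ≡⟨ +-identityʳ _ ⟩
    t i                            ∎

  sum-ends : ∀ {m} (t : Fin (suc (suc m)) → K) → (∀ i → t (Fin.suc (inject₁ i)) ≡ 0#) →
             sum t ≡ t Fin.zero + t (fromℕ (suc m))
  sum-ends t middle≡0 = cong (t Fin.zero +_) (begin
    sum (t ∘ Fin.suc)                                            ≡⟨ sum-init-last (t ∘ Fin.suc) ⟩
    sum (t ∘ Fin.suc ∘ inject₁) + t (fromℕ (suc _))             ≡⟨ cong (_+ _) (sum-zero _ middle≡0) ⟩
    0# + t (fromℕ (suc _))                                       ≡⟨ +-identityˡ _ ⟩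
    t (fromℕ (suc _))                                            ∎)

  sum-sub : ∀ {r} (s t : Fin r → K) → sum (λ i → s i - t i) ≡ sum s - sum t
  sum-sub {zero}  s t = sym (trans (cong (0# +_) -0#≈0#) (+-identityʳ 0#))
  sum-sub {suc r} s t = trans (cong (s Fin.zero - t Fin.zero +_) (sum-sub (s ∘ Fin.suc) (t ∘ Fin.suc)))
                              (shuffle _ _ _ _)
    where
    shuffle : ∀ a b c d → (a - b) + (c - d) ≡ (a + c) - (b + d)
    shuffle = solve 4 (λ a b c d → ((a ⊕ ⊝ b) ⊕ (c ⊕ ⊝ d)) ⊜ ((a ⊕ c) ⊕ ⊝ (b ⊕ d))) refl

  sum-sub-* : ∀ {r} (a b t : Fin r → K) →
              sum (λ i → (a i - b i) * t i) ≡ sum (λ i → a i * t i) - sum (λ i → b i * t i)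
  sum-sub-* a b t = trans (sum-cong-≗ (λ i → [y-z]x≈yx-zx (t i) (a i) (b i)))
                          (sum-sub (λ i → a i * t i) (λ i → b i * t i))

  when : ∀ {P : Set} → Dec P → K → K
  when (yes _) v = v
  when (no _)  _ = 0#

  when-yes : ∀ {P : Set} (P? : Dec P) v → P → when P? v ≡ v
  when-yes (yes _) v _  = refl
  when-yes (no ¬p) v p  = ⊥-elim (¬p p)

  when-no : ∀ {P : Set} (P? : Dec P) v → ¬ P → when P? v ≡ 0#
  when-no (yes p) v ¬p = ⊥-elim (¬p p)
  when-no (no _)  v _  = refl

  peval : List K → K → K
  peval []       x = 0#
  peval (c ∷ cs) x = c + x * peval cs x

  quotient : K → List K → List K
  quotient a []       = []
  quotient a (d ∷ ds) = peval (d ∷ ds) a ∷ quotient a ds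

  length-quotient : ∀ a ds → length (quotient a ds) ≡ length ds
  length-quotient a []       = refl
  length-quotient a (d ∷ ds) = cong suc (length-quotient a ds)

  -- P(x) - P(a) = (x - a) Q(x), written without subtraction
  peval-quotient : ∀ c cs a x →
    peval (c ∷ cs) x + a * peval (quotient a cs) x ≡ peval (c ∷ cs) a + x * peval (quotient a cs) x
  peval-quotient c []       a x = begin
    (c + x * 0#) + a * 0# ≡⟨ cong₂ _+_ (cong (c +_) (zeroʳ x)) (zeroʳ a) ⟩
    (c + 0#) + 0#         ≡⟨ cong₂ _+_ (cong (c +_) (sym (zeroʳ a))) (sym (zeroʳ x)) ⟩
    (c + a * 0#) + x * 0# ∎
  peval-quotient c (d ∷ ds) a x = begin
    (c + x * Px) + a * (Pa + x * Qx) ≡⟨ shuffle c x a Px Pa Qx ⟩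
    (c + a * Pa) + x * (Px + a * Qx) ≡⟨ cong (λ t → (c + a * Pa) + x * t) (peval-quotient d ds a x) ⟩
    (c + a * Pa) + x * (Pa + x * Qx) ∎
    where
    Px = peval (d ∷ ds) x
    Pa = peval (d ∷ ds) a
    Qx = peval (quotient a ds) x
    shuffle : ∀ c x a Px Pa Qx → (c + x * Px) + a * (Pa + x * Qx) ≡ (c + a * Pa) + x * (Px + a * Qx)
    shuffle = solve 6 (λ c x a Px Pa Qx →
      ((c ⊕ x ⊗ Px) ⊕ a ⊗ (Pa ⊕ x ⊗ Qx)) ⊜ ((c ⊕ a ⊗ Pa) ⊕ x ⊗ (Px ⊕ a ⊗ Qx))) refl

  peval-zeros : ∀ {cs} x → All (_≡ 0#) cs → peval cs x ≡ 0#
  peval-zeros x []           = refl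
  peval-zeros x (refl ∷ cs≡0) =
    trans (cong (λ t → 0# + x * t) (peval-zeros x cs≡0)) (trans (cong (0# +_) (zeroʳ x)) (+-identityʳ 0#))

  quotient-zeros : ∀ a ds → All (_≡ 0#) (quotient a ds) → All (_≡ 0#) ds
  quotient-zeros a []       _ = []
  quotient-zeros a (d ∷ ds) (Pa≡0 ∷ Q≡0) = d≡0 ∷ ds≡0
    where
    ds≡0 = quotient-zeros a ds Q≡0
    d≡0 : d ≡ 0#
    d≡0 = begin
      d                         ≡⟨ sym (+-identityʳ d) ⟩
      d + 0#                    ≡⟨ cong (d +_) (sym (trans (cong (a *_) (peval-zeros a ds≡0)) (zeroʳ a))) ⟩
      d + a * peval ds a        ≡⟨ Pa≡0 ⟩
      0#                        ∎

  quotient-root : ∀ {c cs a r} → ¬ a ≡ r → peval (c ∷ cs) a ≡ 0# → peval (c ∷ cs) r ≡ 0# →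
                  peval (quotient a cs) r ≡ 0#
  quotient-root {c} {cs} {a} {r} a≢r Pa≡0 Pr≡0 with peval (quotient a cs) r ≟ 0#
  ... | yes Qr≡0 = Qr≡0
  ... | no Qr≢0  = ⊥-elim (a≢r (*-cancelʳ-≢0 _ Qr≢0 (begin
    a * Qr                          ≡⟨ sym (+-identityˡ _) ⟩
    0# + a * Qr                     ≡⟨ cong (_+ a * Qr) (sym Pr≡0) ⟩
    peval (c ∷ cs) r + a * Qr       ≡⟨ peval-quotient c cs a r ⟩
    peval (c ∷ cs) a + r * Qr       ≡⟨ cong (_+ r * Qr) Pa≡0 ⟩
    0# + r * Qr                     ≡⟨ +-identityˡ _ ⟩
    r * Qr                          ∎)))
    where Qr = peval (quotient a cs) r

  roots⇒zeros : ∀ cs rs → Unique rs → All (λ r → peval cs r ≡ 0#) rs → length cs ≤ length rs →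
                All (_≡ 0#) cs
  roots⇒zeros []       rs       _ _ _ = []
  roots⇒zeros (c ∷ cs) (a ∷ rs) (a∉rs ∷ rs!) (Pa≡0 ∷ Prs≡0) (s≤s |cs|≤|rs|) = c≡0 ∷ cs≡0
    where
    Qrs≡0 : All (λ r → peval (quotient a cs) r ≡ 0#) rs
    Qrs≡0 = All.zipWith (λ (a≢r , Pr≡0) → quotient-root {c} {cs} a≢r Pa≡0 Pr≡0) (a∉rs , Prs≡0)
    cs≡0 : All (_≡ 0#) cs
    cs≡0 = quotient-zeros a cs (roots⇒zeros (quotient a cs) rs rs! Qrs≡0
             (subst (_≤ length rs) (sym (length-quotient a cs)) |cs|≤|rs|))
    c≡0 : c ≡ 0#
    c≡0 = trans (sym (+-identityʳ c))
            (trans (cong (c +_) (sym (trans (cong (a *_) (peval-zeros a cs≡0)) (zeroʳ a)))) Pa≡0)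

  peval-tabulate : ∀ {N} (c : Fin N → K) x → peval (tabulate c) x ≡ sum (λ e → c e * x ^ toℕ e)
  peval-tabulate {zero}  c x = refl
  peval-tabulate {suc N} c x = cong₂ _+_ (sym (*-identityʳ (c Fin.zero))) (begin
    x * peval (tabulate (c ∘ Fin.suc)) x          ≡⟨ cong (x *_) (peval-tabulate (c ∘ Fin.suc) x) ⟩
    x * sum {N} (λ e → c (Fin.suc e) * x ^ toℕ e)     ≡⟨ *-distribˡ-sum {N} x _ ⟩
    sum {N} (λ e → x * (c (Fin.suc e) * x ^ toℕ e))   ≡⟨ sum-cong-≗ {N} (λ e → x*yz≡y*xz x _ _) ⟩
    sum {N} (λ e → c (Fin.suc e) * x ^ suc (toℕ e))   ∎)

  peval-zeros++ : ∀ j cs x → peval (replicate j 0# ++ cs) x ≡ x ^ j * peval cs x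
  peval-zeros++ zero    cs x = sym (*-identityˡ _)
  peval-zeros++ (suc j) cs x = begin
    0# + x * peval (replicate j 0# ++ cs) x  ≡⟨ +-identityˡ _ ⟩
    x * peval (replicate j 0# ++ cs) x       ≡⟨ cong (x *_) (peval-zeros++ j cs x) ⟩
    x * (x ^ j * peval cs x)                 ≡⟨ sym (*-assoc x _ _) ⟩
    x ^ suc j * peval cs x                   ∎

  -- coefficients of the polynomial Σ_{j ≤ l} x^{(1 + d′) j}
  geometric : ℕ → ℕ → List K
  geometric d′ zero    = 1# ∷ []
  geometric d′ (suc l) = 1# ∷ replicate d′ 0# ++ geometric d′ l

  geometric≢zeros : ∀ d′ l → ¬ All (_≡ 0#) (geometric d′ l)
  geometric≢zeros d′ zero    (1≡0 ∷ _) = 0≢1 (sym 1≡0)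
  geometric≢zeros d′ (suc l) (1≡0 ∷ _) = 0≢1 (sym 1≡0)

  length-geometric : ∀ d′ l → length (geometric d′ l) ≡ suc (suc d′ ℕ.* l)
  length-geometric d′ zero    = cong suc (sym (ℕ.*-zeroʳ (suc d′)))
  length-geometric d′ (suc l) = cong suc (begin
    length (replicate d′ 0# ++ geometric d′ l)  ≡⟨ List.length-++ (replicate d′ 0#) ⟩
    length (replicate d′ 0#) ℕ.+ length (geometric d′ l)
      ≡⟨ cong₂ ℕ._+_ (List.length-replicate d′) (length-geometric d′ l) ⟩
    d′ ℕ.+ suc (suc d′ ℕ.* l)                   ≡⟨ ℕ.+-suc d′ _ ⟩
    suc d′ ℕ.+ suc d′ ℕ.* l                      ≡⟨ sym (ℕ.*-suc (suc d′) l) ⟩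
    suc d′ ℕ.* suc l                             ∎)

  -- (y - 1) (1 + y + ⋯ + y^l) = y^{l+1} - 1 for y = x^{1 + d′}, written without subtraction
  peval-geometric : ∀ d′ l x → let y = x ^ suc d′; G = peval (geometric d′ l) x in
                    y * G + 1# ≡ y ^ suc l + G
  peval-geometric d′ zero x = trans (cong (λ t → x ^ suc d′ * t + 1#) G≡1) (cong (x ^ suc d′ * 1# +_) (sym G≡1))
    where
    G≡1 : peval (1# ∷ []) x ≡ 1#
    G≡1 = trans (cong (1# +_) (zeroʳ x)) (+-identityʳ 1#)
  peval-geometric d′ (suc l) x = begin
    y * G′ + 1#              ≡⟨ cong (λ t → y * t + 1#) G′≡1+yG ⟩
    y * (1# + y * G) + 1#    ≡⟨ shuffle₁ y G ⟩
    y * (y * G + 1#) + 1#    ≡⟨ cong (λ t → y * t + 1#) (peval-geometric d′ l x) ⟩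
    y * (y ^ suc l + G) + 1# ≡⟨ shuffle₂ y G (y ^ suc l) ⟩
    y * y ^ suc l + (1# + y * G) ≡⟨ cong (y * y ^ suc l +_) (sym G′≡1+yG) ⟩
    y ^ suc (suc l) + G′     ∎
    where
    y  = x ^ suc d′
    G  = peval (geometric d′ l) x
    G′ = peval (geometric d′ (suc l)) x
    G′≡1+yG : G′ ≡ 1# + y * G
    G′≡1+yG = cong (1# +_) (trans (cong (x *_) (peval-zeros++ d′ (geometric d′ l) x)) (sym (*-assoc x _ _)))
    shuffle₁ : ∀ y G → y * (1# + y * G) + 1# ≡ y * (y * G + 1#) + 1#
    shuffle₁ = solve 2 (λ y G → (y ⊗ (Κ 1# ⊕ y ⊗ G) ⊕ Κ 1#) ⊜ (y ⊗ (y ⊗ G ⊕ Κ 1#) ⊕ Κ 1#)) refl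
    shuffle₂ : ∀ y G Y → y * (Y + G) + 1# ≡ y * Y + (1# + y * G)
    shuffle₂ = solve 3 (λ y G Y → (y ⊗ (Y ⊕ G) ⊕ Κ 1#) ⊜ (y ⊗ Y ⊕ (Κ 1# ⊕ y ⊗ G))) refl

  injection⇒≤|K| : ∀ {N} (ι : Fin N → K) → (∀ {i j} → ι i ≡ ι j → i ≡ j) → N ≤ q ℕ.^ n
  injection⇒≤|K| {N} ι ι-inj = subst (N ≤_) card (ℕ.≮⇒≥ collision)
    where
    position : Fin N → Fin (length elements)
    position i = index (complete (ι i))
    collision : ¬ length elements < N
    collision |K|<N with Fin.pigeonhole |K|<N position
    ... | i , j , i<j , same = Fin.<-irrefl (ι-inj (begin
      ι i                            ≡⟨ lookup-index (complete (ι i)) ⟩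
      lookup elements (position i)   ≡⟨ cong (lookup elements) same ⟩
      lookup elements (position j)   ≡⟨ sym (lookup-index (complete (ι j))) ⟩
      ι j                            ∎)) i<j

  ∑ᴸ : List K → K
  ∑ᴸ = foldr _+_ 0#

  ∏ᴸ : List K → K
  ∏ᴸ = foldr _*_ 1#

  ∑ᴸ-↭ : ∀ {xs ys} → xs ↭ ys → ∑ᴸ xs ≡ ∑ᴸ ys
  ∑ᴸ-↭ = PermProperties.foldr-commMonoid (setoid K) +-isCommutativeMonoid ∘ ↭⇒↭ₛ

  ∏ᴸ-↭ : ∀ {xs ys} → xs ↭ ys → ∏ᴸ xs ≡ ∏ᴸ ys
  ∏ᴸ-↭ = PermProperties.foldr-commMonoid (setoid K) *-isCommutativeMonoid ∘ ↭⇒↭ₛ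

  ∑ᴸ-map-+ : ∀ x xs → ∑ᴸ (map (_+ x) xs) ≡ ∑ᴸ xs + length xs ⨯ x
  ∑ᴸ-map-+ x []       = sym (+-identityʳ 0#)
  ∑ᴸ-map-+ x (y ∷ ys) = trans (cong ((y + x) +_) (∑ᴸ-map-+ x ys)) (shuffle y x (∑ᴸ ys) (length ys ⨯ x))
    where
    shuffle : ∀ a b c d → (a + b) + (c + d) ≡ (a + c) + (b + d)
    shuffle = solve 4 (λ a b c d → ((a ⊕ b) ⊕ (c ⊕ d)) ⊜ ((a ⊕ c) ⊕ (b ⊕ d))) refl

  ∏ᴸ-map-* : ∀ x xs → ∏ᴸ (map (x *_) xs) ≡ x ^ length xs * ∏ᴸ xs
  ∏ᴸ-map-* x []       = sym (*-identityˡ 1#)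
  ∏ᴸ-map-* x (y ∷ ys) = trans (cong ((x * y) *_) (∏ᴸ-map-* x ys)) (shuffle x y (x ^ length ys) (∏ᴸ ys))
    where
    shuffle : ∀ a b c d → (a * b) * (c * d) ≡ (a * c) * (b * d)
    shuffle = solve 4 (λ a b c d → ((a ⊗ b) ⊗ (c ⊗ d)) ⊜ ((a ⊗ c) ⊗ (b ⊗ d))) refl

  ∏ᴸ-≢0 : ∀ {xs} → All (λ y → ¬ y ≡ 0#) xs → ¬ ∏ᴸ xs ≡ 0#
  ∏ᴸ-≢0 []             1≡0 = 0≢1 (sym 1≡0)
  ∏ᴸ-≢0 (y≢0 ∷ ys≢0)       = *-≢0 y≢0 (∏ᴸ-≢0 ys≢0)

  -- translation by x permutes the elements of K
  |K|⨯x≡0 : ∀ x → (q ℕ.^ n) ⨯ x ≡ 0#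
  |K|⨯x≡0 x = subst (λ m → m ⨯ x ≡ 0#) card (sym (+-cancelˡ (∑ᴸ elements) _ _ (begin
    ∑ᴸ elements + 0#                          ≡⟨ +-identityʳ _ ⟩
    ∑ᴸ elements                               ≡⟨ sym (∑ᴸ-↭ translation-permutes) ⟩
    ∑ᴸ (map (_+ x) elements)                  ≡⟨ ∑ᴸ-map-+ x elements ⟩
    ∑ᴸ elements + length elements ⨯ x         ∎)))
    where
    onto : ∀ {y} → y ∈ elements → ∃[ z ] (z ∈ elements × z + x ≡ y)
    onto {y} _ = y - x , complete _ , trans (+-assoc y (- x) x) (trans (cong (y +_) (-‿inverseˡ x)) (+-identityʳ y))
    translation-permutes : map (_+ x) elements ↭ elements
    translation-permutes = map-↭ (_+ x) (+-cancelʳ x _ _) unique (λ _ → complete _) onto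

  nonzero : List K
  nonzero = filter (∁? (_≟ 0#)) elements

  1+|nonzero|≡|K| : suc (length nonzero) ≡ q ℕ.^ n
  1+|nonzero|≡|K| = trans (cong (ℕ._+ length nonzero) (sym |zeros|≡1))
                          (trans (length-filter+length-filter-∁ (_≟ 0#) elements) card)
    where
    zeros = filter (_≟ 0#) elements
    |zeros|≡1 : length zeros ≡ 1
    |zeros|≡1 = ℕ.≤-antisym
      (Unique-All≡⇒length≤1 (Unique.filter⁺ (_≟ 0#) unique)
                            (All.tabulate (proj₂ ∘ ∈-filter⁻ (_≟ 0#) {xs = elements})))
      (∈-length (∈-filter⁺ (_≟ 0#) (complete 0#) refl))

  -- multiplication by x ≠ 0 permutes the nonzero elements
  x^|nonzero|≡1 : ∀ {x} → ¬ x ≡ 0# → x ^ length nonzero ≡ 1#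
  x^|nonzero|≡1 {x} x≢0 = *-cancelʳ-≢0 (∏ᴸ nonzero) (∏ᴸ-≢0 nonzero≢0) (begin
    x ^ length nonzero * ∏ᴸ nonzero   ≡⟨ sym (∏ᴸ-map-* x nonzero) ⟩
    ∏ᴸ (map (x *_) nonzero)           ≡⟨ ∏ᴸ-↭ (map-↭ (x *_) (*-cancelˡ-≢0 x x≢0) nonzero! into onto) ⟩
    ∏ᴸ nonzero                        ≡⟨ sym (*-identityˡ _) ⟩
    1# * ∏ᴸ nonzero                   ∎)
    where
    nonzero! : Unique nonzero
    nonzero! = Unique.filter⁺ (∁? (_≟ 0#)) unique
    ∈nonzero : ∀ {y} → ¬ y ≡ 0# → y ∈ nonzero
    ∈nonzero y≢0 = ∈-filter⁺ (∁? (_≟ 0#)) (complete _) y≢0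
    nonzero≢0 : All (λ y → ¬ y ≡ 0#) nonzero
    nonzero≢0 = All.tabulate (proj₂ ∘ ∈-filter⁻ (∁? (_≟ 0#)) {xs = elements})
    into : ∀ {y} → y ∈ nonzero → x * y ∈ nonzero
    into y∈ = ∈nonzero (*-≢0 x≢0 (All.lookup nonzero≢0 y∈))
    onto : ∀ {y} → y ∈ nonzero → ∃[ z ] (z ∈ nonzero × x * z ≡ y)
    onto {y} y∈ with inverse x x≢0
    ... | x⁻¹ , xx⁻¹≡1 = x⁻¹ * y
      , ∈nonzero (*-≢0 (λ x⁻¹≡0 → 0≢1 (trans (sym (zeroʳ x)) (trans (cong (x *_) (sym x⁻¹≡0)) xx⁻¹≡1)))
                       (All.lookup nonzero≢0 y∈))
      , trans (sym (*-assoc x x⁻¹ y)) (trans (cong (_* y) xx⁻¹≡1) (*-identityˡ y))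

  fermat : ∀ x → x ^ (q ℕ.^ n) ≡ x
  fermat x with x ≟ 0#
  ... | yes refl = subst (λ m → 0# ^ m ≡ 0#) 1+|nonzero|≡|K| (zeroˡ _)
  ... | no x≢0   = subst (λ m → x ^ m ≡ x) 1+|nonzero|≡|K|
                         (trans (cong (x *_) (x^|nonzero|≡1 x≢0)) (*-identityʳ x))

  card≡m^k⇒m⨯1≡0 : ∀ m k → q ≡ m ℕ.^ k → m ⨯ 1# ≡ 0#
  card≡m^k⇒m⨯1≡0 m k q≡m^k with (m ⨯ 1#) ≟ 0#
  ... | yes m⨯1≡0 = m⨯1≡0
  ... | no m⨯1≢0  = ⊥-elim (^-≢0 (k ℕ.* n) m⨯1≢0 (begin
    (m ⨯ 1#) ^ (k ℕ.* n)      ≡⟨ sym (^⨯1 (k ℕ.* n)) ⟩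
    (m ℕ.^ (k ℕ.* n)) ⨯ 1#    ≡⟨ cong (_⨯ 1#) (trans (sym (ℕ.^-*-assoc m k n)) (cong (ℕ._^ n) (sym q≡m^k))) ⟩
    (q ℕ.^ n) ⨯ 1#            ≡⟨ |K|⨯x≡0 1# ⟩
    0#                        ∎))
    where
    ^⨯1 : ∀ j → (m ℕ.^ j) ⨯ 1# ≡ (m ⨯ 1#) ^ j
    ^⨯1 zero    = +-identityʳ 1#
    ^⨯1 (suc j) = trans (×1-homo-* m (m ℕ.^ j)) (cong ((m ⨯ 1#) *_) (^⨯1 j))

  ∣⇒⨯≡0 : ∀ {m l} → m ⨯ 1# ≡ 0# → m ∣ l → ∀ z → l ⨯ z ≡ 0#
  ∣⇒⨯≡0 {m} m⨯1≡0 (divides d refl) z = begin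
    (d ℕ.* m) ⨯ z         ≡⟨ cong (_⨯ z) (ℕ.*-comm d m) ⟩
    (m ℕ.* d) ⨯ z         ≡⟨ sym (×-assocˡ z m d) ⟩
    m ⨯ (d ⨯ z)           ≡⟨ cong (m ⨯_) (sym (*-identityˡ _)) ⟩
    m ⨯ (1# * (d ⨯ z))    ≡⟨ sym (×-assoc-* m 1# (d ⨯ z)) ⟩
    (m ⨯ 1#) * (d ⨯ z)    ≡⟨ cong (_* (d ⨯ z)) m⨯1≡0 ⟩
    0# * (d ⨯ z)          ≡⟨ zeroˡ _ ⟩
    0#                    ∎

  AdditiveExponent : ℕ → Set
  AdditiveExponent e = ∀ x y → (x + y) ^ e ≡ x ^ e + y ^ e

  frobenius : ∀ {p} → Prime p → p ⨯ 1# ≡ 0# → AdditiveExponent p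
  frobenius {zero}          pp = ⊥-elim (¬prime[0] pp)
  frobenius {suc zero}      pp = ⊥-elim (¬prime[1] pp)
  frobenius {p@(suc (suc r))} pp p⨯1≡0 x y = begin
    (x + y) ^ p                   ≡⟨ ^≡Exp^ (x + y) p ⟩
    (x + y) Exp.^ p               ≡⟨ Binomial.theorem commutativeSemiring p x y ⟩
    sum T                         ≡⟨ sum-ends T middle≡0 ⟩
    T Fin.zero + T (fromℕ p)      ≡⟨ cong₂ _+_ first (last (fromℕ p) (Fin.toℕ-fromℕ p)) ⟩
    y ^ p + x ^ p                 ≡⟨ +-comm _ _ ⟩
    x ^ p + y ^ p                 ∎
    where
    T = Binomial.binomialTerm commutativeSemiring x y p
    first : T Fin.zero ≡ y ^ p
    first = trans (+-identityʳ _) (trans (*-identityˡ _) (sym (^≡Exp^ y p)))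
    last : ∀ k → toℕ k ≡ p → T k ≡ x ^ p
    last k k≡p rewrite k≡p | nCn≡1 p | ℕ.n∸n≡0 p =
      trans (+-identityʳ _) (trans (*-identityʳ _) (sym (^≡Exp^ x p)))
    middle≡0 : ∀ i → T (Fin.suc (inject₁ i)) ≡ 0#
    middle≡0 i = ∣⇒⨯≡0 p⨯1≡0 (prime∣C pp (s≤s z≤n) (s≤s k<1+r)) _
      where
      k<1+r : toℕ (inject₁ i) < suc r
      k<1+r = subst (_< suc r) (sym (Fin.toℕ-inject₁ i)) (Fin.toℕ<n i)

  additive-^ : ∀ {e} → AdditiveExponent e → ∀ j → AdditiveExponent (e ℕ.^ j)
  additive-^ additive-e zero    x y = trans (*-identityʳ _) (cong₂ _+_ (sym (*-identityʳ x)) (sym (*-identityʳ y)))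
  additive-^ {e} additive-e (suc j) x y = begin
    (x + y) ^ (e ℕ.* e ℕ.^ j)                  ≡⟨ sym (nest (x + y)) ⟩
    ((x + y) ^ (e ℕ.^ j)) ^ e                  ≡⟨ cong (_^ e) (additive-^ additive-e j x y) ⟩
    (x ^ (e ℕ.^ j) + y ^ (e ℕ.^ j)) ^ e        ≡⟨ additive-e _ _ ⟩
    (x ^ (e ℕ.^ j)) ^ e + (y ^ (e ℕ.^ j)) ^ e  ≡⟨ cong₂ _+_ (nest x) (nest y) ⟩
    x ^ (e ℕ.* e ℕ.^ j) + y ^ (e ℕ.* e ℕ.^ j)  ∎
    where
    nest : ∀ z → (z ^ (e ℕ.^ j)) ^ e ≡ z ^ (e ℕ.* e ℕ.^ j)
    nest z = trans (^-assocʳ z (e ℕ.^ j) e) (cong (z ^_) (ℕ.*-comm (e ℕ.^ j) e))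

  primePower⇒additive : IsPrimePower q → AdditiveExponent q
  primePower⇒additive (p , k , p-prime , _ , q≡p^k) =
    subst AdditiveExponent (sym q≡p^k) (additive-^ (frobenius p-prime (card≡m^k⇒m⨯1≡0 p k q≡p^k)) k)

  -‿^ : ∀ {e} → 1 ≤ e → AdditiveExponent e → ∀ x → (- x) ^ e ≡ - (x ^ e)
  -‿^ {e} 1≤e additive-e x = +-inverseʳ-unique (x ^ e) ((- x) ^ e)
    (trans (sym (additive-e x (- x))) (trans (cong (_^ e) (-‿inverseʳ x)) (0^ 1≤e)))

  additive-sum : ∀ {e} → 1 ≤ e → AdditiveExponent e →
                 ∀ {r} (t : Fin r → K) → sum t ^ e ≡ sum (λ i → t i ^ e)
  additive-sum 1≤e additive-e {zero}  t = 0^ 1≤e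
  additive-sum {e} 1≤e additive-e {suc r} t =
    trans (additive-e _ _) (cong (t Fin.zero ^ e +_) (additive-sum 1≤e additive-e (t ∘ Fin.suc)))

module Fq {q m : ℕ} (𝔽 : FiniteField q (suc m)) (q-primePower : IsPrimePower q) where

  open Setup 𝔽
  open Field 𝔽
  open Solver using (solve; _⊕_; _⊗_; _⊜_)
  open ≡-Reasoning

  1<q : 1 < q
  1<q = primePower⇒>1 q-primePower

  additive-q : AdditiveExponent q
  additive-q = primePower⇒additive q-primePower

  additive-q^ : ∀ i → AdditiveExponent (q ℕ.^ i)
  additive-q^ = additive-^ additive-q

  1≤q^ : ∀ i → 1 ≤ q ℕ.^ i
  1≤q^ i = ℕ.m^n>0 q i
    where instance _ = ℕ.>-nonZero (ℕ.<-trans (s≤s z≤n) 1<q)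

  InFq-^q^ : ∀ {c} → InFq c → ∀ i → c ^ (q ℕ.^ i) ≡ c
  InFq-^q^ {c} c^q≡c zero    = *-identityʳ c
  InFq-^q^ {c} c^q≡c (suc i) = begin
    c ^ (q ℕ.* q ℕ.^ i)    ≡⟨ cong (c ^_) (ℕ.*-comm q (q ℕ.^ i)) ⟩
    c ^ (q ℕ.^ i ℕ.* q)    ≡⟨ sym (^-assocʳ c (q ℕ.^ i) q) ⟩
    (c ^ (q ℕ.^ i)) ^ q    ≡⟨ cong (_^ q) (InFq-^q^ c^q≡c i) ⟩
    c ^ q                  ≡⟨ c^q≡c ⟩
    c                      ∎

  InFq-- : ∀ {a b} → InFq a → InFq b → InFq (a - b)
  InFq-- {a} {b} a^q≡a b^q≡b = begin
    (a - b) ^ q         ≡⟨ additive-q a (- b) ⟩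
    a ^ q + (- b) ^ q   ≡⟨ cong₂ _+_ a^q≡a (-‿^ (ℕ.<⇒≤ 1<q) additive-q b) ⟩
    a + - (b ^ q)       ≡⟨ cong (λ t → a + - t) b^q≡b ⟩
    a - b               ∎

  q^ : Fin (suc m) → ℕ
  q^ i = q ℕ.^ toℕ i

  eval-0 : ∀ f → eval f 0# ≡ 0#
  eval-0 f = trans (eval≡sum f 0#) (sum-zero _ λ i → trans (cong (f i *_) (0^ (1≤q^ (toℕ i)))) (zeroʳ (f i)))

  eval-Fq-linear : ∀ f {c} → InFq c → ∀ x z → eval f (c * x + z) ≡ c * eval f x + eval f z
  eval-Fq-linear f {c} c∈Fq x z = begin
    eval f (c * x + z)                                       ≡⟨ eval≡sum f _ ⟩
    sum (monomials f (c * x + z))                            ≡⟨ sum-cong-≗ term ⟩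
    sum (λ i → c * monomials f x i + monomials f z i)
      ≡⟨ ∑-distrib-+ (λ i → c * monomials f x i) (monomials f z) ⟩
    sum (λ i → c * monomials f x i) + sum (monomials f z)
      ≡⟨ cong (_+ sum (monomials f z)) (sym (*-distribˡ-sum c (monomials f x))) ⟩
    c * sum (monomials f x) + sum (monomials f z)
      ≡⟨ sym (cong₂ _+_ (cong (c *_) (eval≡sum f x)) (eval≡sum f z)) ⟩
    c * eval f x + eval f z                                  ∎
    where
    term : ∀ i → f i * (c * x + z) ^ q^ i ≡ c * (f i * x ^ q^ i) + f i * z ^ q^ i
    term i = begin
      f i * (c * x + z) ^ q^ i             ≡⟨ cong (f i *_) (additive-q^ (toℕ i) (c * x) z) ⟩
      f i * ((c * x) ^ q^ i + z ^ q^ i)      ≡⟨ cong (λ t → f i * (t + z ^ q^ i)) (^-distrib-* c x (q^ i)) ⟩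
      f i * (c ^ q^ i * x ^ q^ i + z ^ q^ i)
        ≡⟨ cong (λ t → f i * (t * x ^ q^ i + z ^ q^ i)) (InFq-^q^ c∈Fq (toℕ i)) ⟩
      f i * (c * x ^ q^ i + z ^ q^ i)      ≡⟨ shuffle (f i) c (x ^ q^ i) (z ^ q^ i) ⟩
      c * (f i * x ^ q^ i) + f i * z ^ q^ i ∎
      where
      shuffle : ∀ a c X Z → a * (c * X + Z) ≡ c * (a * X) + a * Z
      shuffle = solve 4 (λ a c X Z → (a ⊗ (c ⊗ X ⊕ Z)) ⊜ (c ⊗ (a ⊗ X) ⊕ a ⊗ Z)) refl

  U-comb : ∀ g₁ g₂ {r} (c xs : Fin r → K) → OnK.FqCoeffs c →
           U g₁ g₂ (OnK.comb c xs) ≡ OnK².comb c (U g₁ g₂ ∘ xs)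
  U-comb g₁ g₂ {zero}  c xs _    = cong₂ _,_ (eval-0 g₁) (eval-0 g₂)
  U-comb g₁ g₂ {suc r} c xs c∈Fq = cong₂ _,_ (step g₁ (cong proj₁ U-tail)) (step g₂ (cong proj₂ U-tail))
    where
    U-tail = U-comb g₁ g₂ (c ∘ Fin.suc) (xs ∘ Fin.suc) (c∈Fq ∘ Fin.suc)
    step : ∀ g {t} → eval g (OnK.comb (c ∘ Fin.suc) (xs ∘ Fin.suc)) ≡ t →
           eval g (OnK.comb c xs) ≡ c Fin.zero * eval g (xs Fin.zero) + t
    step g tail≡t = trans (eval-Fq-linear g (c∈Fq Fin.zero) _ _) (cong (c Fin.zero * eval g (xs Fin.zero) +_) tail≡t)

  comb≡sum : ∀ {r} (c y : Fin r → K) → OnK.comb c y ≡ sum (λ i → c i * y i)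
  comb≡sum {zero}  c y = refl
  comb≡sum {suc r} c y = cong (c Fin.zero * y Fin.zero +_) (comb≡sum (c ∘ Fin.suc) (y ∘ Fin.suc))

  comb-injective : ∀ {r} {y : Fin r → K} → OnK.FqIndependent y →
                   ∀ {c c′} → OnK.FqCoeffs c → OnK.FqCoeffs c′ →
                   OnK.comb c y ≡ OnK.comb c′ y → ∀ i → c i ≡ c′ i
  comb-injective {y = y} y-independent {c} {c′} c∈Fq c′∈Fq same i =
    x∙y⁻¹≈ε⇒x≈y _ _ (y-independent (λ j → c j - c′ j) (λ j → InFq-- (c∈Fq j) (c′∈Fq j)) difference≡0 i)
    where
    difference≡0 : OnK.comb (λ j → c j - c′ j) y ≡ 0#
    difference≡0 = begin
      OnK.comb (λ j → c j - c′ j) y                  ≡⟨ comb≡sum _ y ⟩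
      sum (λ j → (c j - c′ j) * y j)                 ≡⟨ sum-sub-* c c′ y ⟩
      sum (λ j → c j * y j) - sum (λ j → c′ j * y j) ≡⟨ sym (cong₂ _-_ (comb≡sum c y) (comb≡sum c′ y)) ⟩
      OnK.comb c y - OnK.comb c′ y                   ≡⟨ x≈y⇒x∙y⁻¹≈ε same ⟩
      0#                                             ∎

  InFq? : Decidable InFq
  InFq? x = (x ^ q) ≟ x

  Fq-elements : List K
  Fq-elements = filter InFq? elements

  Fq-elements! : Unique Fq-elements
  Fq-elements! = Unique.filter⁺ InFq? unique

  InFq-lookup : ∀ i → InFq (lookup Fq-elements i)
  InFq-lookup i = proj₂ (∈-filter⁻ InFq? {xs = elements} (∈-lookup i))

  -- the elements outside F_q are roots of 1 + y + ⋯ + y^l, y = x^{q-1}, where q^{m+1} - 1 = (q - 1)(l + 1)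
  private module Count {d′ l : ℕ} (q≡2+d′ : 2 ℕ.+ d′ ≡ q) (|K|≡ : q ℕ.^ suc m ≡ suc (suc d′ ℕ.* suc l)) where

    y : K → K
    y x = x ^ suc d′

    ∉Fq⇒geometric-root : ∀ {x} → ¬ InFq x → peval (geometric d′ l) x ≡ 0#
    ∉Fq⇒geometric-root {x} x∉Fq with peval (geometric d′ l) x ≟ 0#
    ... | yes G≡0 = G≡0
    ... | no G≢0  = ⊥-elim (y≢1 (*-cancelʳ-≢0 _ G≢0 (+-cancelʳ 1# _ _ (begin
      y x * G + 1#            ≡⟨ peval-geometric d′ l x ⟩
      y x ^ suc l + G         ≡⟨ cong (_+ G) y^[1+l]≡1 ⟩
      1# + G                  ≡⟨ +-comm 1# G ⟩
      G + 1#                  ≡⟨ cong (_+ 1#) (sym (*-identityˡ G)) ⟩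
      1# * G + 1#             ∎))))
      where
      G = peval (geometric d′ l) x
      x^q≡x*y : x ^ q ≡ x * y x
      x^q≡x*y = cong (x ^_) (sym q≡2+d′)
      y≢1 : ¬ y x ≡ 1#
      y≢1 y≡1 = x∉Fq (trans x^q≡x*y (trans (cong (x *_) y≡1) (*-identityʳ x)))
      x≢0 : ¬ x ≡ 0#
      x≢0 refl = x∉Fq (trans x^q≡x*y (zeroˡ _))
      y^[1+l]≡1 : y x ^ suc l ≡ 1#
      y^[1+l]≡1 = *-cancelˡ-≢0 x x≢0 (begin
        x * y x ^ suc l                    ≡⟨ cong (x *_) (^-assocʳ x (suc d′) (suc l)) ⟩
        x ^ suc (suc d′ ℕ.* suc l)         ≡⟨ cong (x ^_) (sym |K|≡) ⟩
        x ^ (q ℕ.^ suc m)                  ≡⟨ fermat x ⟩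
        x                                  ≡⟨ sym (*-identityʳ x) ⟩
        x * 1#                             ∎)

    outside : List K
    outside = filter (∁? InFq?) elements

    |outside|≤ : length outside ≤ suc d′ ℕ.* l
    |outside|≤ with length (geometric d′ l) ℕ.≤? length outside
    ... | no  long = ℕ.≤-pred (subst (length outside <_) (length-geometric d′ l) (ℕ.≰⇒> long))
    ... | yes short = ⊥-elim (geometric≢zeros d′ l (roots⇒zeros (geometric d′ l) outside
      (Unique.filter⁺ (∁? InFq?) unique)
      (All.tabulate (∉Fq⇒geometric-root ∘ proj₂ ∘ ∈-filter⁻ (∁? InFq?) {xs = elements}))
      short))

    q≤|Fq| : q ≤ length Fq-elements
    q≤|Fq| = ℕ.+-cancelʳ-≤ (length outside) q (length Fq-elements)
                (subst (q ℕ.+ length outside ≤_) count (ℕ.+-monoʳ-≤ q |outside|≤))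
      where
      count : q ℕ.+ suc d′ ℕ.* l ≡ length Fq-elements ℕ.+ length outside
      count = begin
        q ℕ.+ suc d′ ℕ.* l                       ≡⟨ cong (ℕ._+ suc d′ ℕ.* l) (sym q≡2+d′) ⟩
        suc (suc d′ ℕ.+ suc d′ ℕ.* l)            ≡⟨ cong suc (sym (ℕ.*-suc (suc d′) l)) ⟩
        suc (suc d′ ℕ.* suc l)                   ≡⟨ sym |K|≡ ⟩
        q ℕ.^ suc m                              ≡⟨ sym card ⟩
        length elements                          ≡⟨ sym (length-filter+length-filter-∁ InFq? elements) ⟩
        length Fq-elements ℕ.+ length outside    ∎

  q≤|Fq| : q ≤ length Fq-elements
  q≤|Fq| with ℕ.m≤n⇒∃[o]m+o≡n 1<q
  ... | d′ , 2+d′≡q with pow-form (suc d′) m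
  ...   | l , |K|≡ = Count.q≤|Fq| 2+d′≡q (trans (cong (ℕ._^ suc m) (sym 2+d′≡q)) |K|≡)

  -- distinct F_q-coordinates give distinct elements, so |F_q|^r ≤ |K|
  independent⇒≤ : ∀ {r} (y : Fin r → K) → OnK.FqIndependent y → r ≤ suc m
  independent⇒≤ {r} y y-independent = ℕ.≮⇒≥ λ 1+m<r → ℕ.<⇒≱ (ℕ.^-monoʳ-< q 1<q 1+m<r) q^r≤|K|
    where
    coordinates : Fin (length Fq-elements ℕ.^ r) → Fin r → K
    coordinates t j = lookup Fq-elements (Fin.finToFun t j)
    ι-injective : ∀ {s t} → OnK.comb (coordinates s) y ≡ OnK.comb (coordinates t) y → s ≡ t
    ι-injective same = finToFun-injective λ j → lookup-injective Fq-elements! _ _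
      (comb-injective y-independent (InFq-lookup ∘ Fin.finToFun _) (InFq-lookup ∘ Fin.finToFun _) same j)
    q^r≤|K| : q ℕ.^ r ≤ q ℕ.^ suc m
    q^r≤|K| = ℕ.≤-trans (ℕ.^-monoˡ-≤ r q≤|Fq|)
                        (injection⇒≤|K| (λ t → OnK.comb (coordinates t) y) ι-injective)

  q^<|K| : ∀ i → q^ i < q ℕ.^ suc m
  q^<|K| i = ℕ.^-monoʳ-< q 1<q (Fin.toℕ<n i)

  q^-injective : ∀ {i j} → q^ i ≡ q^ j → i ≡ j
  q^-injective = Fin.toℕ-injective ∘ ^-injectiveʳ 1<q

  -- Σ a_i x^{q^i} as an ordinary polynomial of degree < q^{m+1}: the coefficient of x^e,
  -- and the position of x^{q^i} among the monomials
  coefficient : V → Fin (q ℕ.^ suc m) → K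
  coefficient a e = sum λ i → when (toℕ e ℕ.≟ q^ i) (a i)

  exponent : Fin (suc m) → Fin (q ℕ.^ suc m)
  exponent i = Fin.fromℕ< (q^<|K| i)

  toℕ-exponent : ∀ i → toℕ (exponent i) ≡ q^ i
  toℕ-exponent i = Fin.toℕ-fromℕ< (q^<|K| i)

  peval-linearised : ∀ a x → peval (tabulate (coefficient a)) x ≡ eval a x
  peval-linearised a x = begin
    peval (tabulate (coefficient a)) x
      ≡⟨ peval-tabulate (coefficient a) x ⟩
    sum (λ e → coefficient a e * x ^ toℕ e)
      ≡⟨ sum-cong-≗ {q ℕ.^ suc m} (λ e → *-distribʳ-sum (x ^ toℕ e) (λ i → when (toℕ e ℕ.≟ q^ i) (a i))) ⟩
    sum (λ e → sum (λ i → term e i))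
      ≡⟨ ∑-comm term ⟩
    sum (λ i → sum (λ e → term e i))
      ≡⟨ sum-cong-≗ (λ i → sum-spike (λ e → term e i) (exponent i) (off-exponent i)) ⟩
    sum (λ i → term (exponent i) i)
      ≡⟨ sum-cong-≗ on-exponent ⟩
    sum (monomials a x)
      ≡⟨ sym (eval≡sum a x) ⟩
    eval a x ∎
    where
    term : Fin (q ℕ.^ suc m) → Fin (suc m) → K
    term e i = when (toℕ e ℕ.≟ q^ i) (a i) * x ^ toℕ e
    off-exponent : ∀ i e → ¬ e ≡ exponent i → term e i ≡ 0#
    off-exponent i e e≢ = trans (cong (_* _) (when-no (toℕ e ℕ.≟ q^ i) (a i)
      λ e≡q^i → e≢ (Fin.toℕ-injective (trans e≡q^i (sym (toℕ-exponent i)))))) (zeroˡ _)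
    on-exponent : ∀ i → term (exponent i) i ≡ a i * x ^ q^ i
    on-exponent i = cong₂ _*_ (when-yes (toℕ (exponent i) ℕ.≟ q^ i) (a i) (toℕ-exponent i))
                              (cong (x ^_) (toℕ-exponent i))

  eval≡0⇒≐0 : ∀ a → (∀ x → eval a x ≡ 0#) → a ≐ 0V
  eval≡0⇒≐0 a eval≡0 i = begin
    a i                                          ≡⟨ sym (when-yes (toℕ e ℕ.≟ q^ i) (a i) (toℕ-exponent i)) ⟩
    when (toℕ e ℕ.≟ q^ i) (a i)                  ≡⟨ sym (sum-spike _ i off-diagonal) ⟩
    coefficient a e                              ≡⟨ All-tabulate⁻ coefficients≡0 e ⟩
    0#                                           ∎
    where
    e = exponent i
    off-diagonal : ∀ j → ¬ j ≡ i → when (toℕ e ℕ.≟ q^ j) (a j) ≡ 0#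
    off-diagonal j j≢i = when-no (toℕ e ℕ.≟ q^ j) (a j) (j≢i ∘ sym ∘ q^-injective ∘ trans (sym (toℕ-exponent i)))
    coefficients≡0 : All (_≡ 0#) (tabulate (coefficient a))
    coefficients≡0 = roots⇒zeros (tabulate (coefficient a)) elements unique
      (All.tabulate λ {x} _ → trans (peval-linearised a x) (eval≡0 x))
      (ℕ.≤-reflexive (trans (List.length-tabulate _) (sym card)))

  eval-injective : ∀ a b → (∀ x → eval a x ≡ eval b x) → a ≐ b
  eval-injective a b same i = x∙y⁻¹≈ε⇒x≈y (a i) (b i) (eval≡0⇒≐0 (λ j → a j - b j) difference≡0 i)
    where
    difference≡0 : ∀ x → eval (λ j → a j - b j) x ≡ 0#
    difference≡0 x = begin
      eval (λ j → a j - b j) x                    ≡⟨ eval≡sum (λ j → a j - b j) x ⟩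
      sum (λ j → (a j - b j) * x ^ q^ j)          ≡⟨ sum-sub-* a b (λ j → x ^ q^ j) ⟩
      sum (monomials a x) - sum (monomials b x)   ≡⟨ sym (cong₂ _-_ (eval≡sum a x) (eval≡sum b x)) ⟩
      eval a x - eval b x                         ≡⟨ x≈y⇒x∙y⁻¹≈ε (same x) ⟩
      0#                                          ∎

  -- the coefficients of x ↦ f(x)^q: those of f raised to the q-th power and rotated, as x^{q^{m+1}} = x
  frobenius∘ : V → V
  frobenius∘ f Fin.zero    = f (fromℕ m) ^ q
  frobenius∘ f (Fin.suc j) = f (inject₁ j) ^ q

  eval-frobenius∘ : ∀ f x → eval (frobenius∘ f) x ≡ eval f x ^ q
  eval-frobenius∘ f x = sym (begin
    eval f x ^ q                                   ≡⟨ cong (_^ q) (eval≡sum f x) ⟩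
    sum (monomials f x) ^ q                        ≡⟨ additive-sum (ℕ.<⇒≤ 1<q) additive-q (monomials f x) ⟩
    sum (λ i → monomials f x i ^ q)                ≡⟨ sum-init-last (λ i → monomials f x i ^ q) ⟩
    sum (λ j → monomials f x (inject₁ j) ^ q) + monomials f x (fromℕ m) ^ q
      ≡⟨ cong₂ _+_ (sum-cong-≗ inner) outer ⟩
    sum (F ∘ Fin.suc) + F Fin.zero                 ≡⟨ +-comm _ _ ⟩
    sum F                                          ≡⟨ sym (eval≡sum (frobenius∘ f) x) ⟩
    eval (frobenius∘ f) x                          ∎)
    where
    F = monomials (frobenius∘ f) x
    raised : ∀ i → monomials f x i ^ q ≡ f i ^ q * x ^ (q ℕ.^ suc (toℕ i))
    raised i = trans (^-distrib-* (f i) _ q)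
                     (cong (f i ^ q *_) (trans (^-assocʳ x (q^ i) q) (cong (x ^_) (ℕ.*-comm (q^ i) q))))
    inner : ∀ j → monomials f x (inject₁ j) ^ q ≡ F (Fin.suc j)
    inner j = trans (raised (inject₁ j)) (cong (λ k → f (inject₁ j) ^ q * x ^ (q ℕ.^ suc k)) (Fin.toℕ-inject₁ j))
    outer : monomials f x (fromℕ m) ^ q ≡ F Fin.zero
    outer = trans (raised (fromℕ m)) (cong (f (fromℕ m) ^ q *_) (begin
      x ^ (q ℕ.^ suc (toℕ (fromℕ m)))  ≡⟨ cong (λ k → x ^ (q ℕ.^ suc k)) (Fin.toℕ-fromℕ m) ⟩
      x ^ (q ℕ.^ suc m)                ≡⟨ fermat x ⟩
      x                                ≡⟨ sym (*-identityʳ x) ⟩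
      x ^ q^ Fin.zero                  ∎))

  eval-scale : ∀ w f x → eval (λ i → w * f i) x ≡ w * eval f x
  eval-scale w f x = begin
    eval (λ i → w * f i) x             ≡⟨ eval≡sum (λ i → w * f i) x ⟩
    sum (λ i → (w * f i) * x ^ q^ i)   ≡⟨ sum-cong-≗ (λ i → *-assoc w (f i) (x ^ q^ i)) ⟩
    sum (λ i → w * monomials f x i)    ≡⟨ sym (*-distribˡ-sum w (monomials f x)) ⟩
    w * sum (monomials f x)            ≡⟨ cong (w *_) (sym (eval≡sum f x)) ⟩
    w * eval f x                       ∎

  -- the values are fixed by x ↦ x^q, hence so are the coefficients under frobenius∘: h(x) = Tr(h₀ x)
  Fq-valued⇒trace-form : ∀ h → (∀ x → InFq (eval h x)) → ∀ i → h i ≡ h Fin.zero ^ q^ i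
  Fq-valued⇒trace-form h h[x]∈Fq i = powers (toℕ i) i refl
    where
    β = h Fin.zero
    h-fixed : frobenius∘ h ≐ h
    h-fixed = eval-injective (frobenius∘ h) h λ x → trans (eval-frobenius∘ h x) (h[x]∈Fq x)
    powers : ∀ k i → toℕ i ≡ k → h i ≡ β ^ q^ i
    powers zero    Fin.zero    _  = sym (*-identityʳ β)
    powers (suc k) (Fin.suc j) eq = begin
      h (Fin.suc j)                    ≡⟨ sym (h-fixed (Fin.suc j)) ⟩
      h (inject₁ j) ^ q                ≡⟨ cong (_^ q) (powers k (inject₁ j) (trans (Fin.toℕ-inject₁ j) (ℕ.suc-injective eq))) ⟩
      (β ^ q^ (inject₁ j)) ^ q         ≡⟨ ^-assocʳ β (q^ (inject₁ j)) q ⟩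
      β ^ (q^ (inject₁ j) ℕ.* q)       ≡⟨ cong (λ k → β ^ (q ℕ.^ k ℕ.* q)) (Fin.toℕ-inject₁ j) ⟩
      β ^ (q ℕ.^ toℕ j ℕ.* q)          ≡⟨ cong (β ^_) (ℕ.*-comm (q ℕ.^ toℕ j) q) ⟩
      β ^ q^ (Fin.suc j)               ∎

  rank-one-form : ∀ g → HasRank g 1 →
    ∃[ c ] ∃[ β ] (¬ c ≡ 0# × ¬ β ≡ 0# × ∀ i → g i ≡ c * β ^ q^ i)
  rank-one-form g (v , hit , v-independent , image⊆cFq) = c , β , c≢0 , β≢0 , g≡cβ^
    where
    c = v Fin.zero
    c≢0 : ¬ c ≡ 0#
    c≢0 c≡0 = 0≢1 (sym (v-independent (λ _ → 1#) (λ _ → 1^ q)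
      (trans (+-identityʳ _) (trans (*-identityˡ c) c≡0)) Fin.zero))
    c⁻¹ = proj₁ (inverse c c≢0)
    c*c⁻¹≡1 : c * c⁻¹ ≡ 1#
    c*c⁻¹≡1 = proj₂ (inverse c c≢0)
    h : V
    h i = c⁻¹ * g i
    h[x]∈Fq : ∀ x → InFq (eval h x)
    h[x]∈Fq x with image⊆cFq x
    ... | a , a∈Fq , g[x]≡ac+0 = subst InFq (sym (begin
      eval h x                 ≡⟨ eval-scale c⁻¹ g x ⟩
      c⁻¹ * eval g x           ≡⟨ cong (c⁻¹ *_) (trans g[x]≡ac+0 (+-identityʳ _)) ⟩
      c⁻¹ * (a Fin.zero * c)   ≡⟨ x*yz≡y*xz c⁻¹ _ c ⟩
      a Fin.zero * (c⁻¹ * c)   ≡⟨ cong (a Fin.zero *_) (trans (*-comm c⁻¹ c) c*c⁻¹≡1) ⟩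
      a Fin.zero * 1#          ≡⟨ *-identityʳ _ ⟩
      a Fin.zero               ∎)) (a∈Fq Fin.zero)
    β = h Fin.zero
    g≡cβ^ : ∀ i → g i ≡ c * β ^ q^ i
    g≡cβ^ i = begin
      g i                  ≡⟨ sym (*-identityˡ (g i)) ⟩
      1# * g i             ≡⟨ cong (_* g i) (sym c*c⁻¹≡1) ⟩
      (c * c⁻¹) * g i      ≡⟨ *-assoc c c⁻¹ (g i) ⟩
      c * h i              ≡⟨ cong (c *_) (Fq-valued⇒trace-form h h[x]∈Fq i) ⟩
      c * β ^ q^ i         ∎
    β≢0 : ¬ β ≡ 0#
    β≢0 β≡0 with hit Fin.zero
    ... | x , g[x]≡c = c≢0 (trans (sym g[x]≡c) (eval-≐0 g g≐0 x))
      where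
      g≐0 : g ≐ 0V
      g≐0 i = begin
        g i              ≡⟨ g≡cβ^ i ⟩
        c * β ^ q^ i     ≡⟨ cong (λ b → c * b ^ q^ i) β≡0 ⟩
        c * 0# ^ q^ i    ≡⟨ cong (c *_) (0^ (1≤q^ (toℕ i))) ⟩
        c * 0#           ≡⟨ zeroʳ c ⟩
        0#               ∎

  dual-rank-one⇒common-root : ∀ {f₁ f₂} g → InDual f₁ f₂ g → HasRank g 1 →
    ∃[ β ] (¬ β ≡ 0# × ∀ f → InSpan f₁ f₂ f → eval f β ≡ 0#)
  dual-rank-one⇒common-root g g∈C⊥ g-rank-one with rank-one-form g g-rank-one
  ... | c , β , c≢0 , β≢0 , g≡cβ^ = β , β≢0 , root
    where
    root : ∀ f → InSpan _ _ f → eval f β ≡ 0#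
    root f f∈C with x*y≡0⇒x≡0⊎y≡0 c*f[β]≡0
      where
      c*f[β]≡0 : c * eval f β ≡ 0#
      c*f[β]≡0 = begin
        c * eval f β                       ≡⟨ sym (eval-scale c f β) ⟩
        eval (λ i → c * f i) β             ≡⟨ eval≡sum (λ i → c * f i) β ⟩
        sum (λ i → (c * f i) * β ^ q^ i)   ≡⟨ sum-cong-≗ (λ i → trans (cong (_* β ^ q^ i) (*-comm c (f i))) (*-assoc (f i) c _)) ⟩
        sum (λ i → f i * (c * β ^ q^ i))   ≡⟨ sum-cong-≗ (λ i → cong (f i *_) (sym (g≡cβ^ i))) ⟩
        sum (λ i → f i * g i)              ≡⟨ sym (sumFin≡sum (λ i → f i * g i)) ⟩
        sumFin (λ i → f i * g i)           ≡⟨ g∈C⊥ f f∈C ⟩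
        0#                                 ∎
    ... | inj₁ c≡0     = ⊥-elim (c≢0 c≡0)
    ... | inj₂ f[β]≡0 = f[β]≡0

  comb²-cong : ∀ {r} (c : Fin r → K) {v v′ : Fin r → K²} → (∀ i → v i ≡ v′ i) →
               OnK².comb c v ≡ OnK².comb c v′
  comb²-cong {zero}  c v≗v′ = refl
  comb²-cong {suc r} c v≗v′ =
    cong₂ _⊕²_ (cong (c Fin.zero ·²_) (v≗v′ Fin.zero)) (comb²-cong (c ∘ Fin.suc) (v≗v′ ∘ Fin.suc))

  comb-zeros : ∀ {r} (c y : Fin r → K) → (∀ i → c i ≡ 0#) → OnK.comb c y ≡ 0#
  comb-zeros c y c≡0 = trans (comb≡sum c y) (sum-zero _ λ i → trans (cong (_* y i) (c≡0 i)) (zeroˡ (y i)))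

  -- β together with preimages of an F_q-basis of U_{g₁,g₂} would be m + 2 independent elements of K
  common-root⇒¬rank : ∀ g₁ g₂ {β} → ¬ β ≡ 0# → eval g₁ β ≡ 0# → eval g₂ β ≡ 0# →
                      ¬ LinearSetRank g₁ g₂ (suc m)
  common-root⇒¬rank g₁ g₂ {β} β≢0 g₁[β]≡0 g₂[β]≡0 (w , hit , w-independent , _) =
    ℕ.<-irrefl refl (independent⇒≤ y y-independent)
    where
    xs : Fin (suc m) → K
    xs i = proj₁ (hit i)
    y : Fin (suc (suc m)) → K
    y Fin.zero    = β
    y (Fin.suc i) = xs i
    y-independent : OnK.FqIndependent y
    y-independent c c∈Fq comb≡0 = c≡0
      where
      vanishing-head : ∀ {a t} → a ≡ 0# → c Fin.zero * a + t ≡ t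
      vanishing-head {a} {t} a≡0 =
        trans (cong (λ s → c Fin.zero * s + t) a≡0) (trans (cong (_+ t) (zeroʳ _)) (+-identityˡ t))
      tail-comb≡0 : OnK².comb (c ∘ Fin.suc) w ≡ 0²
      tail-comb≡0 = begin
        OnK².comb (c ∘ Fin.suc) w               ≡⟨ comb²-cong (c ∘ Fin.suc) (λ i → sym (proj₂ (hit i))) ⟩
        OnK².comb (c ∘ Fin.suc) (U g₁ g₂ ∘ xs)
          ≡⟨ sym (cong₂ _,_ (vanishing-head g₁[β]≡0) (vanishing-head g₂[β]≡0)) ⟩
        OnK².comb c (U g₁ g₂ ∘ y)                       ≡⟨ sym (U-comb g₁ g₂ c y c∈Fq) ⟩
        U g₁ g₂ (OnK.comb c y)                          ≡⟨ cong (U g₁ g₂) comb≡0 ⟩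
        U g₁ g₂ 0#                                      ≡⟨ cong₂ _,_ (eval-0 g₁) (eval-0 g₂) ⟩
        0²                                              ∎
      tail≡0 : ∀ i → c (Fin.suc i) ≡ 0#
      tail≡0 = w-independent (c ∘ Fin.suc) (c∈Fq ∘ Fin.suc) tail-comb≡0
      head≡0 : c Fin.zero ≡ 0#
      head≡0 with x*y≡0⇒x≡0⊎y≡0 (trans (sym (+-identityʳ _))
                    (trans (cong (c Fin.zero * β +_) (sym (comb-zeros (c ∘ Fin.suc) xs tail≡0))) comb≡0))
      ... | inj₁ c₀≡0 = c₀≡0
      ... | inj₂ β≡0  = ⊥-elim (β≢0 β≡0)
      c≡0 : ∀ i → c i ≡ 0#
      c≡0 Fin.zero    = head≡0
      c≡0 (Fin.suc i) = tail≡0 i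

mainTheorem17 : (q n : ℕ) → IsPrimePower q → 1 ≤ n → (𝔽 : FiniteField q n) →
    let open Setup 𝔽 in
    (f1 f2 : V) → SomeProperRankN f1 f2 →
    -- B_1 = 0 : no element of C^⊥ has rank 1
    ¬ (∃[ g ] (InDual f1 f2 g × HasRank g 1))
mainTheorem17 q zero    _ () _
mainTheorem17 q (suc m) q-primePower _ 𝔽 f1 f2
              (g1 , g2 , (g1∈C , g2∈C , _) , _ , rank-n) (g , g∈C⊥ , g-rank-one) =
  let β , β≢0 , root = dual-rank-one⇒common-root g g∈C⊥ g-rank-one
  in common-root⇒¬rank g1 g2 β≢0 (root g1 g1∈C) (root g2 g2∈C) rank-n
  where open Fq 𝔽 q-primePower
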